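{- Let $p$ be a positive integer. An oriented graph $D$ is $(=p)$-invertible if and only if there is a $(=p)$-invertible tournament $T$ with $V(T)=V(D)$ having $D$ as a spanning oriented subgraph.
   Context: For an oriented graph $D$ and $X\subseteq V(D)$, the inversion of $X$ reverses the orientation of every arc with both endpoints in $X$. A $(=p)$-inversion is the inversion of a set of exactly $p$ vertices. An oriented graph is $(=p)$-invertible if it can be made acyclic by a (finite, possibly empty) sequence of $(=p)$-inversions. -}

module Defs where

open import Data.Nat using (ℕ; suc)
open import Data.Bool using (Bool; true; false; _∧_; if_then_else_)
open import Data.Fin using (Fin)
open import Data.Fin.Subset using (Subset; ∣_∣)
open import Data.Vec using (lookup)
open import Data.List using (List; []; _∷_)
open import Data.List.Relation.Unary.All using (All)
open import Data.Product using (Σ; _×_; ∃; ∃-syntax)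
open import Data.Sum using (_⊎_)
open import Relation.Binary.PropositionalEquality using (_≡_; _≢_)
open import Relation.Nullary using (¬_)

-- A digraph on vertex set Fin n, given by its (decidable) arc relation:
-- arc u v ≡ true  means there is an arc u → v.
Digraph : ℕ → Set
Digraph n = Fin n → Fin n → Bool

IsOriented : ∀ {n} → Digraph n → Set
IsOriented {n} D =
  (∀ (u : Fin n) → D u u ≡ false) ×
  (∀ (u v : Fin n) → D u v ≡ true → D v u ≡ false)

IsTournament : ∀ {n} → Digraph n → Set
IsTournament {n} T =
  IsOriented T × (∀ (u v : Fin n) → u ≢ v → (T u v ≡ true) ⊎ (T v u ≡ true))

-- D is a (spanning, since the vertex sets coincide) subdigraph of T.
IsSubgraph : ∀ {n} → Digraph n → Digraph n → Set
IsSubgraph {n} D T = ∀ (u v : Fin n) → D u v ≡ true → T u v ≡ true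

invert : ∀ {n} → Subset n → Digraph n → Digraph n
invert X D u v = if lookup X u ∧ lookup X v then D v u else D u v

invertAll : ∀ {n} → List (Subset n) → Digraph n → Digraph n
invertAll [] D = D
invertAll (X ∷ Xs) D = invertAll Xs (invert X D)

data Walk {n} (D : Digraph n) : Fin n → Fin n → ℕ → Set where
  here : ∀ {u} → Walk D u u 0
  step : ∀ {u w v k} → D u w ≡ true → Walk D w v k → Walk D u v (suc k)

-- Acyclic: no directed closed walk of positive length (equivalently no directed cycle).
IsAcyclic : ∀ {n} → Digraph n → Set
IsAcyclic {n} D = ∀ (u : Fin n) (k : ℕ) → ¬ Walk D u u (suc k)

IsEqInvertible : ℕ → ∀ {n} → Digraph n → Set
IsEqInvertible p {n} D =
  ∃[ Xs ] (All (λ X → ∣ X ∣ ≡ p) Xs × IsAcyclic (invertAll Xs D))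

-- An inversion is an involution and commutes with taking subgraphs, so a
-- sequence of inversions is undone by the reversed sequence, maps tournaments
-- to tournaments and preserves the subgraph relation. If inverting X₁,…,Xₖ
-- makes D acyclic, extend the resulting acyclic digraph to an acyclic
-- tournament T′ (order the vertices topologically by peeling off sources) and
-- invert Xₖ,…,X₁ in T′: this is a tournament containing D which X₁,…,Xₖ make
-- acyclic. Conversely, inversions making a tournament acyclic make each of its
-- subgraphs acyclic.
module Submission where

open import Defs
open import Data.Nat using (ℕ; _≥_)
open import Data.Product using (_×_; ∃-syntax)
open import Function.Bundles using (_⇔_)

open import Level using (Level)
open import Data.Nat using (zero; suc; _+_; _∸_; z<s; s<s)
open import Data.Nat.GeneralisedArithmetic using (fold; fold-+)
import Data.Nat.Properties as ℕ
open import Data.Bool using (true; false; _∧_)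
import Data.Bool as Bool
open import Data.Fin using (Fin; toℕ; punchIn; punchOut; _≟_)
open import Data.Fin.Properties using (pigeonhole; ¬∀⟶∃¬; any?; all?; toℕ-injective; punchIn-punchOut)
open import Data.Fin.Subset using (Subset)
open import Data.Vec using (lookup)
open import Data.List using (List; []; _∷_; _++_; reverse)
open import Data.List.Properties using (unfold-reverse; reverse-involutive)
open import Data.Product using (_,_; ∃; proj₁; proj₂)
open import Data.Product.Relation.Binary.Lex.Strict using (×-strictTotalOrder)
open import Data.Sum using (_⊎_; inj₁; inj₂; swap)
open import Data.Empty using (⊥-elim)
open import Relation.Binary using (StrictPartialOrder; StrictTotalOrder; Tri; tri<; tri≈; tri>)
open import Relation.Binary.PropositionalEquality using (_≡_; _≢_; refl; sym; trans; cong; subst; subst₂; module ≡-Reasoning)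
open import Relation.Nullary using (yes; no; does)
open import Relation.Nullary.Decidable using (dec-true; dec-false)
open import Function.Bundles using (mk⇔)

private
  variable
    n m : ℕ
    D E F : Digraph n

_≐_ : Digraph n → Digraph n → Set
D ≐ E = ∀ u v → D u v ≡ E u v

≐-sym : D ≐ E → E ≐ D
≐-sym D≐E u v = sym (D≐E u v)

≐-trans : D ≐ E → E ≐ F → D ≐ F
≐-trans D≐E E≐F u v = trans (D≐E u v) (E≐F u v)

≐⇒⊆ : D ≐ E → IsSubgraph D E
≐⇒⊆ D≐E u v Duv = trans (sym (D≐E u v)) Duv

⊆-trans : IsSubgraph D E → IsSubgraph E F → IsSubgraph D F
⊆-trans D⊆E E⊆F u v Duv = E⊆F u v (D⊆E u v Duv)

walk-mono : IsSubgraph D E → ∀ {u v k} → Walk D u v k → Walk E u v k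
walk-mono D⊆E here         = here
walk-mono D⊆E (step e walk) = step (D⊆E _ _ e) (walk-mono D⊆E walk)

acyclic-antimono : IsSubgraph D E → IsAcyclic E → IsAcyclic D
acyclic-antimono D⊆E acyclic u k walk = acyclic u k (walk-mono D⊆E walk)

invert-cong : (X : Subset n) → D ≐ E → invert X D ≐ invert X E
invert-cong X D≐E u v with lookup X u ∧ lookup X v
... | true  = D≐E v u
... | false = D≐E u v

invert-mono : (X : Subset n) → IsSubgraph D E → IsSubgraph (invert X D) (invert X E)
invert-mono X D⊆E u v with lookup X u ∧ lookup X v
... | true  = D⊆E v u
... | false = D⊆E u v

invert-involutive : (X : Subset n) (D : Digraph n) → invert X (invert X D) ≐ D
invert-involutive X D u v with lookup X u | lookup X v
... | true  | true  = refl
... | true  | false = refl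
... | false | true  = refl
... | false | false = refl

invert-tournament : (X : Subset n) → IsTournament D → IsTournament (invert X D)
invert-tournament {D = D} X ((loopless , oriented) , complete) =
  (loopless′ , oriented′) , complete′
  where
  loopless′ : ∀ u → invert X D u u ≡ false
  loopless′ u with lookup X u ∧ lookup X u
  ... | true  = loopless u
  ... | false = loopless u

  oriented′ : ∀ u v → invert X D u v ≡ true → invert X D v u ≡ false
  oriented′ u v with lookup X u | lookup X v
  ... | true  | true  = oriented v u
  ... | true  | false = oriented u v
  ... | false | true  = oriented u v
  ... | false | false = oriented u v

  complete′ : ∀ u v → u ≢ v → (invert X D u v ≡ true) ⊎ (invert X D v u ≡ true)
  complete′ u v u≢v with lookup X u | lookup X v
  ... | true  | true  = swap (complete u v u≢v)
  ... | true  | false = complete u v u≢v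
  ... | false | true  = complete u v u≢v
  ... | false | false = complete u v u≢v

invertAll-cong : (Xs : List (Subset n)) → D ≐ E → invertAll Xs D ≐ invertAll Xs E
invertAll-cong []       D≐E = D≐E
invertAll-cong (X ∷ Xs) D≐E = invertAll-cong Xs (invert-cong X D≐E)

invertAll-mono : (Xs : List (Subset n)) → IsSubgraph D E → IsSubgraph (invertAll Xs D) (invertAll Xs E)
invertAll-mono []       D⊆E = D⊆E
invertAll-mono (X ∷ Xs) D⊆E = invertAll-mono Xs (invert-mono X D⊆E)

invertAll-tournament : (Xs : List (Subset n)) → IsTournament D → IsTournament (invertAll Xs D)
invertAll-tournament []       t = t
invertAll-tournament (X ∷ Xs) t = invertAll-tournament Xs (invert-tournament X t)

invertAll-++ : (Xs Ys : List (Subset n)) (D : Digraph n) →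
               invertAll (Xs ++ Ys) D ≡ invertAll Ys (invertAll Xs D)
invertAll-++ []       Ys D = refl
invertAll-++ (X ∷ Xs) Ys D = invertAll-++ Xs Ys (invert X D)

invertAll-reverse-∷ : (X : Subset n) (Xs : List (Subset n)) (D : Digraph n) →
                      invertAll (reverse (X ∷ Xs)) D ≡ invert X (invertAll (reverse Xs) D)
invertAll-reverse-∷ X Xs D = trans (cong (λ Ys → invertAll Ys D) (unfold-reverse X Xs))
                                   (invertAll-++ (reverse Xs) (X ∷ []) D)

invertAll-reverseˡ : (Xs : List (Subset n)) (D : Digraph n) →
                     invertAll (reverse Xs) (invertAll Xs D) ≐ D
invertAll-reverseˡ []       D u v = refl
invertAll-reverseˡ (X ∷ Xs) D rewrite invertAll-reverse-∷ X Xs (invertAll Xs (invert X D)) =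
  ≐-trans (invert-cong X (invertAll-reverseˡ Xs (invert X D))) (invert-involutive X D)

invertAll-reverseʳ : (Xs : List (Subset n)) (D : Digraph n) →
                     invertAll Xs (invertAll (reverse Xs) D) ≐ D
invertAll-reverseʳ Xs D =
  subst (λ Ys → invertAll Ys (invertAll (reverse Xs) D) ≐ D)
        (reverse-involutive Xs)
        (invertAll-reverseˡ (reverse Xs) D)

module _ {a ℓ₁ ℓ₂ : Level} (O : StrictPartialOrder a ℓ₁ ℓ₂) where
  open StrictPartialOrder O renaming (trans to <-trans)

  IsIncreasing : Digraph n → (Fin n → Carrier) → Set ℓ₂
  IsIncreasing D f = ∀ u v → D u v ≡ true → f u < f v

  walk-increasing : ∀ {f : Fin n → Carrier} → IsIncreasing D f →
                    ∀ {u v k} → Walk D u v (suc k) → f u < f v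
  walk-increasing inc (step e here)            = inc _ _ e
  walk-increasing inc (step e walk@(step _ _)) = <-trans (inc _ _ e) (walk-increasing inc walk)

  increasing⇒acyclic : ∀ {f : Fin n → Carrier} → IsIncreasing D f → IsAcyclic D
  increasing⇒acyclic inc u k walk = irrefl Eq.refl (walk-increasing inc walk)

module _ {a ℓ₁ ℓ₂ : Level} (O : StrictTotalOrder a ℓ₁ ℓ₂) where
  open StrictTotalOrder O hiding (trans)

  orderedBy : (Fin n → Carrier) → Digraph n
  orderedBy f u v = does (f u <? f v)

  orderedBy-increasing : (f : Fin n → Carrier) → IsIncreasing strictPartialOrder (orderedBy f) f
  orderedBy-increasing f u v with f u <? f v
  ... | yes fu<fv = λ _ → fu<fv
  ... | no  _     = λ ()

  orderedBy-tournament : (f : Fin n → Carrier) → (∀ {u v} → f u ≈ f v → u ≡ v) →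
                         IsTournament (orderedBy f)
  orderedBy-tournament f f-injective = (loopless , oriented) , complete
    where
    loopless : ∀ u → orderedBy f u u ≡ false
    loopless u = dec-false (f u <? f u) (irrefl Eq.refl)

    oriented : ∀ u v → orderedBy f u v ≡ true → orderedBy f v u ≡ false
    oriented u v uv = dec-false (f v <? f u) (asym (orderedBy-increasing f u v uv))

    complete : ∀ u v → u ≢ v → (orderedBy f u v ≡ true) ⊎ (orderedBy f v u ≡ true)
    complete u v u≢v = fromTri (compare (f u) (f v))
      where
      fromTri : Tri (f u < f v) (f u ≈ f v) (f v < f u) →
                (orderedBy f u v ≡ true) ⊎ (orderedBy f v u ≡ true)
      fromTri (tri< fu<fv _ _) = inj₁ (dec-true (f u <? f v) fu<fv)
      fromTri (tri≈ _ fu≈fv _) = ⊥-elim (u≢v (f-injective fu≈fv))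
      fromTri (tri> _ _ fv<fu) = inj₂ (dec-true (f v <? f u) fv<fu)

IsSource : Digraph n → Fin n → Set
IsSource D s = ∀ u → D u s ≢ true

-- Walk backwards along chosen in-neighbours; by pigeonhole the walk revisits a vertex.
predecessors⇒closedWalk : {D : Digraph (suc m)} (pred : Fin (suc m) → Fin (suc m)) →
                          (∀ v → D (pred v) v ≡ true) → ∃[ u ] ∃[ k ] Walk D u u (suc k)
predecessors⇒closedWalk {m = m} {D = D} pred arc
  with i , j , i<j , same ← pigeonhole (ℕ.n<1+n (suc m)) (λ i → fold Fin.zero pred (toℕ i)) =
  x , d , subst (λ y → Walk D y x (suc d)) closes (chain (suc d) x)
  where
  x : Fin (suc m)
  x = fold Fin.zero pred (toℕ i)

  d : ℕ
  d = toℕ j ∸ suc (toℕ i)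

  chain : ∀ k y → Walk D (fold y pred k) y k
  chain zero    y = here
  chain (suc k) y = step (arc (fold y pred k)) (chain k y)

  closes : fold x pred (suc d) ≡ x
  closes = begin
    fold x pred (suc d)                  ≡⟨ fold-+ Fin.zero pred (suc d) ⟨
    fold Fin.zero pred (suc d + toℕ i)   ≡⟨ cong (fold Fin.zero pred)
                                               (trans (sym (ℕ.+-suc d (toℕ i))) (ℕ.m∸n+n≡m i<j)) ⟩
    fold Fin.zero pred (toℕ j)           ≡⟨ same ⟨
    x                                    ∎
    where open ≡-Reasoning

acyclic⇒source : {D : Digraph (suc m)} → IsAcyclic D → ∃ (IsSource D)
acyclic⇒source {D = D} acyclic with all? (λ v → any? (λ u → D u v Bool.≟ true))
... | yes hasPred =
  let u , k , walk = predecessors⇒closedWalk (λ v → proj₁ (hasPred v)) (λ v → proj₂ (hasPred v))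
  in ⊥-elim (acyclic u k walk)
... | no ¬hasPred =
  let s , noPred = ¬∀⟶∃¬ _ _ (λ v → any? (λ u → D u v Bool.≟ true)) ¬hasPred
  in s , λ u Dus → noPred (u , Dus)

deleteVertex : Fin (suc n) → Digraph (suc n) → Digraph n
deleteVertex s D u v = D (punchIn s u) (punchIn s v)

walk-deleteVertex : ∀ {s : Fin (suc n)} {u v k} →
                    Walk (deleteVertex s D) u v k → Walk D (punchIn s u) (punchIn s v) k
walk-deleteVertex here          = here
walk-deleteVertex (step e walk) = step e (walk-deleteVertex walk)

deleteVertex-acyclic : (s : Fin (suc n)) → IsAcyclic D → IsAcyclic (deleteVertex s D)
deleteVertex-acyclic s acyclic u k walk = acyclic (punchIn s u) k (walk-deleteVertex walk)

IsRanking : Digraph n → (Fin n → ℕ) → Set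
IsRanking = IsIncreasing ℕ.<-strictPartialOrder

extendRank : Fin (suc n) → (Fin n → ℕ) → Fin (suc n) → ℕ
extendRank s r v with s ≟ v
... | yes _  = 0
... | no s≢v = suc (r (punchOut s≢v))

extendRank-ranking : ∀ {s : Fin (suc n)} {r : Fin n → ℕ} → IsSource D s →
                     IsRanking (deleteVertex s D) r → IsRanking D (extendRank s r)
extendRank-ranking {D = D} {s = s} source ranking u v Duv with s ≟ u | s ≟ v
... | _        | yes refl = ⊥-elim (source u Duv)
... | yes refl | no _     = z<s
... | no s≢u   | no s≢v  = s<s (ranking _ _ (subst₂ (λ a b → D a b ≡ true)
                                     (sym (punchIn-punchOut s≢u)) (sym (punchIn-punchOut s≢v)) Duv))

acyclic⇒ranking : ∀ {n} {D : Digraph n} → IsAcyclic D → ∃ (IsRanking D)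
acyclic⇒ranking {zero}  _       = (λ ()) , λ ()
acyclic⇒ranking {suc n} acyclic =
  let s , source  = acyclic⇒source acyclic
      r , ranking = acyclic⇒ranking (deleteVertex-acyclic s acyclic)
  in extendRank s r , extendRank-ranking source ranking

acyclic⇒⊆acyclicTournament : ∀ {n} {D : Digraph n} → IsAcyclic D →
                             ∃[ T ] (IsTournament T × IsAcyclic T × IsSubgraph D T)
acyclic⇒⊆acyclicTournament {n} acyclic =
  let r , ranking = acyclic⇒ranking acyclic
      -- ranks may tie; breaking ties by index makes the lexicographic key injective
      key : Fin n → ℕ × ℕ
      key v = r v , toℕ v
  in orderedBy lex key ,
     orderedBy-tournament lex key (λ (_ , same) → toℕ-injective same) ,
     increasing⇒acyclic (StrictTotalOrder.strictPartialOrder lex) (orderedBy-increasing lex key) ,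
     (λ u v Duv → dec-true (StrictTotalOrder._<?_ lex (key u) (key v)) (inj₁ (ranking u v Duv)))
  where
  lex : StrictTotalOrder _ _ _
  lex = ×-strictTotalOrder ℕ.<-strictTotalOrder ℕ.<-strictTotalOrder

lemma3p8 : (p : ℕ) → p ≥ 1 → (n : ℕ) → (D : Digraph n) → IsOriented D →
    IsEqInvertible p D ⇔ (∃[ T ] (IsTournament T × IsEqInvertible p T × IsSubgraph D T))
lemma3p8 p _ n D _ = mk⇔ extend restrict
  where
  extend : IsEqInvertible p D → ∃[ T ] (IsTournament T × IsEqInvertible p T × IsSubgraph D T)
  extend (Xs , sizes , acyclic) =
    let T′ , tournament , acyclic′ , D′⊆T′ = acyclic⇒⊆acyclicTournament acyclic
        Ys = reverse Xs
    in invertAll Ys T′ ,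
       invertAll-tournament Ys tournament ,
       (Xs , sizes , acyclic-antimono (≐⇒⊆ (invertAll-reverseʳ Xs T′)) acyclic′) ,
       ⊆-trans (≐⇒⊆ (≐-sym (invertAll-reverseˡ Xs D))) (invertAll-mono Ys D′⊆T′)

  restrict : ∃[ T ] (IsTournament T × IsEqInvertible p T × IsSubgraph D T) → IsEqInvertible p D
  restrict (T , _ , (Xs , sizes , acyclic) , D⊆T) =
    Xs , sizes , acyclic-antimono (invertAll-mono Xs D⊆T) acyclic
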